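{- For every integer $n\ge 3$, the complete bipartite graph $K_{n,n}$ satisfies $\mathrm{tcw}(K_{n,n})=2n-2$.
   Context: For a multigraph $G$ and $V'\subseteq V(G)$, $\delta_G(V')$ denotes the multiset of edges with exactly one endpoint in $V'$. A treecut decomposition of $G$ is a pair $(T,\chi)$ where $T$ is a rooted tree and $\chi:V(T)\to 2^{V(G)}$ is such that $\{\chi(t):t\in V(T)\}$ is a near partition of $V(G)$ (the sets $\chi(t)$ are pairwise disjoint, may be empty, and their union is $V(G)$). For $t\in V(T)$ let $T_t$ be the subtree rooted at $t$ and $V_t=\bigcup_{s\in V(T_t)}\chi(s)$. The adhesion of $t$ is $\mathrm{ad}(t)=\delta_G(V_t)$, and the torsowidth $\mathrm{tor}(t)$ is $|\chi(t)|$ plus the number of neighbours of $t$ in $T$. The width of $(T,\chi)$ is the maximum over $t\in V(T)$ of $\max\{|\mathrm{ad}(t)|,\mathrm{tor}(t)\}$, and $\mathrm{tcw}(G)$ is the minimum width of a treecut decomposition of $G$. (This is the treecut width for $3$-edge-connected graphs.) -}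

module Defs where

open import Data.Nat using (ℕ; zero; suc; _+_; _*_; _∸_; _≤_; _<_)
open import Data.Bool using (Bool; true; false; if_then_else_; _xor_)
open import Data.Fin using (Fin; _↑ˡ_; _↑ʳ_)
open import Data.Fin.Subset using (Subset; ⊥; _∪_; ∣_∣)
open import Data.Vec using (lookup)
open import Data.List using (List; []; _∷_; length; cartesianProductWith; allFin)
open import Data.Product using (Σ; _×_; _,_)
open import Data.Unit using (⊤)
open import Relation.Nullary using (¬_)
open import Relation.Binary.PropositionalEquality using (_≡_)

record Multigraph : Set where
  field
    vertices : ℕ
    edges    : List (Fin vertices × Fin vertices)
open Multigraph public

cutSize : ∀ {m} → List (Fin m × Fin m) → Subset m → ℕ
cutSize [] S = 0
cutSize ((u , v) ∷ es) S =
  (if lookup S u xor lookup S v then 1 else 0) + cutSize es S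

data RTree (A : Set) : Set where
  node : A → List (RTree A) → RTree A

mutual
  bags : ∀ {A} → RTree A → List A
  bags (node b cs) = b ∷ bagsF cs

  bagsF : ∀ {A} → List (RTree A) → List A
  bagsF [] = []
  bagsF (c ∷ cs) = Data.List._++_ (bags c) (bagsF cs)

mutual
  subtreeSet : ∀ {m} → RTree (Subset m) → Subset m
  subtreeSet (node b cs) = b ∪ subtreeSetF cs

  subtreeSetF : ∀ {m} → List (RTree (Subset m)) → Subset m
  subtreeSetF [] = ⊥
  subtreeSetF (c ∷ cs) = subtreeSet c ∪ subtreeSetF cs

occurrences : ∀ {m} → Fin m → List (Subset m) → ℕ
occurrences v [] = 0
occurrences v (b ∷ bs) = (if lookup b v then 1 else 0) + occurrences v bs

NearPartition : ∀ {m} → RTree (Subset m) → Set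
NearPartition {m} t = ∀ (v : Fin m) → occurrences v (bags t) ≡ 1

-- Every node t of the (sub)tree has |ad(t)| ≤ w and tor(t) ≤ w, where
-- tor(t) = |χ(t)| + #children + (1 if t has a parent, else 0).
mutual
  NodesOK : (G : Multigraph) → ℕ → (isRoot : Bool) → RTree (Subset (vertices G)) → Set
  NodesOK G w r t@(node b cs) =
    (cutSize (edges G) (subtreeSet t) ≤ w)
    × (∣ b ∣ + length cs + (if r then 0 else 1) ≤ w)
    × NodesOKF G w cs

  NodesOKF : (G : Multigraph) → ℕ → List (RTree (Subset (vertices G))) → Set
  NodesOKF G w [] = ⊤
  NodesOKF G w (c ∷ cs) = NodesOK G w false c × NodesOKF G w cs

HasTreecutDecompOfWidth≤ : Multigraph → ℕ → Set
HasTreecutDecompOfWidth≤ G w =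
  Σ (RTree (Subset (vertices G))) λ T → NearPartition T × NodesOK G w true T

TreecutWidth≡ : Multigraph → ℕ → Set
TreecutWidth≡ G k =
  HasTreecutDecompOfWidth≤ G k × (∀ w → w < k → ¬ HasTreecutDecompOfWidth≤ G w)

K : ℕ → Multigraph
K n = record
  { vertices = n + n
  ; edges = cartesianProductWith (λ i j → (i ↑ˡ n , n ↑ʳ j)) (allFin n) (allFin n)
  }

-- A vertex set of K_{n,n} with at least two vertices on each side of the cut is crossed by at
-- least 2n − 2 edges. So in a decomposition of width w < 2n − 2 every non-root subtree, whose
-- vertex set is small and has small adhesion, carries at most one vertex; then the root's subtree
-- has at most |χ(root)| + #children ≤ w < 2n vertices, although it is the whole vertex set.
-- Conversely, two matched pairs {ℓ₀, r₀}, {ℓ₁, r₁} as leaves below a root bag holding the other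
-- 2n − 4 vertices give adhesion 2(n − 1) at the leaves and torso width 2n − 2 at the root.
module Submission where

open import Defs
open import Data.Nat using (ℕ; zero; suc; _+_; _*_; _∸_; _≤_; _<_; z≤n; s≤s; _≤?_)
open import Data.Nat.Properties
open import Algebra.Properties.CommutativeSemigroup +-commutativeSemigroup using (interchange; x∙yz≈y∙xz)
open import Data.Bool using (true; false; if_then_else_; _xor_)
open import Data.Fin using (Fin; zero; suc; _↑ˡ_; _↑ʳ_; splitAt)
open import Data.Fin.Properties using (splitAt⁻¹-↑ˡ; splitAt⁻¹-↑ʳ)
open import Data.Fin.Subset using (Subset; inside; outside; ⊤; ⁅_⁆; ∁; _∪_; _∈_; _⊆_; ∣_∣)
open import Data.Fin.Subset.Properties
  using (∣⊥∣≡0; ∣⊤∣≡n; ∣⁅x⁆∣≡1; ∣∁p∣≡n∸∣p∣; ∣p∣≤n; ⊆-trans; ⊆-antisym; ⊆⊤; p⊆p∪q; q⊆p∪q; ∪-identityʳ)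
open import Data.Vec using ([]; _∷_; lookup; _++_; map)
open import Data.Vec.Properties using (lookup-++ˡ; lookup-++ʳ; lookup-replicate; lookup⇒[]=; map-++; map-id)
open import Data.List using (List; []; _∷_; length; tabulate; cartesianProductWith; allFin)
  renaming (_++_ to _++ₗ_; map to mapₗ)
open import Data.List.Membership.Propositional using () renaming (_∈_ to _∈ₗ_)
open import Data.List.Membership.Propositional.Properties using (∈-++⁻)
open import Data.List.Relation.Unary.Any using (here; there)
open import Data.Product using (∃-syntax; _×_; _,_)
open import Data.Sum using (inj₁; inj₂)
open import Data.Unit using (tt)
open import Data.Empty using (⊥-elim)
open import Function using (_∘_)
open import Relation.Nullary using (¬_; yes; no)
open import Relation.Binary.PropositionalEquality

∣p++q∣≡∣p∣+∣q∣ : ∀ {m n} (p : Subset m) (q : Subset n) → ∣ p ++ q ∣ ≡ ∣ p ∣ + ∣ q ∣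
∣p++q∣≡∣p∣+∣q∣ []          q = refl
∣p++q∣≡∣p∣+∣q∣ (true ∷ p)  q = cong suc (∣p++q∣≡∣p∣+∣q∣ p q)
∣p++q∣≡∣p∣+∣q∣ (false ∷ p) q = ∣p++q∣≡∣p∣+∣q∣ p q

∣∁[p++q]∣≡∣∁p∣+∣∁q∣ : ∀ {m n} (p : Subset m) (q : Subset n) → ∣ ∁ (p ++ q) ∣ ≡ ∣ ∁ p ∣ + ∣ ∁ q ∣
∣∁[p++q]∣≡∣∁p∣+∣∁q∣ p q = trans (cong ∣_∣ (map-++ _ p q)) (∣p++q∣≡∣p∣+∣q∣ (∁ p) (∁ q))

∣p∪q∣≤∣p∣+∣q∣ : ∀ {n} (p q : Subset n) → ∣ p ∪ q ∣ ≤ ∣ p ∣ + ∣ q ∣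
∣p∪q∣≤∣p∣+∣q∣ []          []          = z≤n
∣p∪q∣≤∣p∣+∣q∣ (true ∷ p)  (true ∷ q)  =
  s≤s (≤-trans (∣p∪q∣≤∣p∣+∣q∣ p q) (+-monoʳ-≤ ∣ p ∣ (n≤1+n ∣ q ∣)))
∣p∪q∣≤∣p∣+∣q∣ (true ∷ p)  (false ∷ q) = s≤s (∣p∪q∣≤∣p∣+∣q∣ p q)
∣p∪q∣≤∣p∣+∣q∣ (false ∷ p) (true ∷ q)  =
  ≤-trans (s≤s (∣p∪q∣≤∣p∣+∣q∣ p q)) (≤-reflexive (sym (+-suc ∣ p ∣ ∣ q ∣)))
∣p∪q∣≤∣p∣+∣q∣ (false ∷ p) (false ∷ q) = ∣p∪q∣≤∣p∣+∣q∣ p q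

∣p∣+∣∁p∣≡n : ∀ {n} (p : Subset n) → ∣ p ∣ + ∣ ∁ p ∣ ≡ n
∣p∣+∣∁p∣≡n p = trans (cong (∣ p ∣ +_) (∣∁p∣≡n∸∣p∣ p)) (m+[n∸m]≡n (∣p∣≤n p))

cutSize-++ : ∀ {m} (es fs : List (Fin m × Fin m)) S →
             cutSize (es ++ₗ fs) S ≡ cutSize es S + cutSize fs S
cutSize-++ []             fs S = refl
cutSize-++ ((u , v) ∷ es) fs S =
  trans (cong (_ +_) (cutSize-++ es fs S)) (sym (+-assoc (if lookup S u xor lookup S v then 1 else 0) _ _))

cutSize-⊤ : ∀ {m} (es : List (Fin m × Fin m)) → cutSize es ⊤ ≡ 0
cutSize-⊤ []             = refl
cutSize-⊤ ((u , v) ∷ es) rewrite lookup-replicate u inside | lookup-replicate v inside = cutSize-⊤ es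

mutual
  bag⊆subtreeSet : ∀ {m} (t : RTree (Subset m)) {b} → b ∈ₗ bags t → b ⊆ subtreeSet t
  bag⊆subtreeSet (node b cs) (here refl) = p⊆p∪q (subtreeSetF cs)
  bag⊆subtreeSet (node b cs) (there b∈) = ⊆-trans (bag⊆subtreeSetF cs b∈) (q⊆p∪q b (subtreeSetF cs))

  bag⊆subtreeSetF : ∀ {m} (cs : List (RTree (Subset m))) {b} → b ∈ₗ bagsF cs → b ⊆ subtreeSetF cs
  bag⊆subtreeSetF (c ∷ cs) b∈ with ∈-++⁻ (bags c) b∈
  ... | inj₁ b∈c  = ⊆-trans (bag⊆subtreeSet c b∈c) (p⊆p∪q (subtreeSetF cs))
  ... | inj₂ b∈cs = ⊆-trans (bag⊆subtreeSetF cs b∈cs) (q⊆p∪q (subtreeSet c) (subtreeSetF cs))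

occurrences≢0⇒∈bag : ∀ {m} (v : Fin m) bs → occurrences v bs ≢ 0 → ∃[ b ] b ∈ₗ bs × v ∈ b
occurrences≢0⇒∈bag v []       occ≢0 = ⊥-elim (occ≢0 refl)
occurrences≢0⇒∈bag v (b ∷ bs) occ≢0 with lookup b v in v∈b
... | true  = b , here refl , lookup⇒[]= v b v∈b
... | false with occurrences≢0⇒∈bag v bs occ≢0
...   | b′ , b′∈bs , v∈b′ = b′ , there b′∈bs , v∈b′

subtreeSet≡⊤ : ∀ {m} (T : RTree (Subset m)) → NearPartition T → subtreeSet T ≡ ⊤
subtreeSet≡⊤ T partition = ⊆-antisym ⊆⊤ (λ {v} _ → covered v)
  where
  covered : ∀ v → v ∈ subtreeSet T
  covered v with occurrences≢0⇒∈bag v (bags T) (λ occ≡0 → 1+n≢0 (trans (sym (partition v)) occ≡0))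
  ... | b , b∈T , v∈b = bag⊆subtreeSet T b∈T v∈b

SmallCutSetsAreTiny : Multigraph → ℕ → Set
SmallCutSetsAreTiny G w = ∀ S → cutSize (edges G) S ≤ w → ∣ S ∣ ≤ w → ∣ S ∣ ≤ 1

module _ (G : Multigraph) (w : ℕ) (tiny : SmallCutSetsAreTiny G w) where

  mutual
    ∣subtreeSet∣≤width : ∀ r t → NodesOK G w r t → ∣ subtreeSet t ∣ ≤ w
    ∣subtreeSet∣≤width r (node b cs) (_ , tor≤w , cs-ok) = begin
      ∣ b ∪ subtreeSetF cs ∣                  ≤⟨ ∣p∪q∣≤∣p∣+∣q∣ b (subtreeSetF cs) ⟩
      ∣ b ∣ + ∣ subtreeSetF cs ∣              ≤⟨ +-monoʳ-≤ ∣ b ∣ (∣subtreeSetF∣≤length cs cs-ok) ⟩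
      ∣ b ∣ + length cs                       ≤⟨ m≤m+n _ _ ⟩
      ∣ b ∣ + length cs + (if r then 0 else 1) ≤⟨ tor≤w ⟩
      w                                       ∎
      where open ≤-Reasoning

    ∣subtreeSetF∣≤length : ∀ cs → NodesOKF G w cs → ∣ subtreeSetF cs ∣ ≤ length cs
    ∣subtreeSetF∣≤length [] _ = ≤-reflexive (∣⊥∣≡0 (vertices G))
    ∣subtreeSetF∣≤length (c@(node _ _) ∷ cs) (c-ok@(ad≤w , _) , cs-ok) =
      ≤-trans (∣p∪q∣≤∣p∣+∣q∣ (subtreeSet c) (subtreeSetF cs))
              (+-mono-≤ (tiny _ ad≤w (∣subtreeSet∣≤width false c c-ok)) (∣subtreeSetF∣≤length cs cs-ok))

  vertices≤width : HasTreecutDecompOfWidth≤ G w → vertices G ≤ w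
  vertices≤width (T , partition , ok) =
    subst (_≤ w) (trans (cong ∣_∣ (subtreeSet≡⊤ T partition)) (∣⊤∣≡n _)) (∣subtreeSet∣≤width true T ok)

mismatches : ∀ {k n} → Subset k → Subset n → ℕ
mismatches xs ys = ∣ xs ∣ * ∣ ∁ ys ∣ + ∣ ∁ xs ∣ * ∣ ys ∣

mismatches-∷ : ∀ {k n} x (xs : Subset k) (ys : Subset n) →
               ∣ map (x xor_) ys ∣ + mismatches xs ys ≡ mismatches (x ∷ xs) ys
mismatches-∷ true  xs ys = sym (+-assoc ∣ ∁ ys ∣ _ _)
mismatches-∷ false xs ys = trans (cong (_+ mismatches xs ys) (cong ∣_∣ (map-id ys)))
                                 (x∙yz≈y∙xz ∣ ys ∣ (∣ xs ∣ * ∣ ∁ ys ∣) (∣ ∁ xs ∣ * ∣ ys ∣))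

module _ {n : ℕ} (S : Subset (n + n)) where

  cutSize-row : ∀ u {k} (ys : Subset k) (h : Fin k → Fin n) → (∀ j → lookup S (n ↑ʳ h j) ≡ lookup ys j) →
                cutSize (mapₗ (λ j → (u , n ↑ʳ j)) (tabulate h)) S ≡ ∣ map (lookup S u xor_) ys ∣
  cutSize-row u []       h right = refl
  cutSize-row u (y ∷ ys) h right rewrite right zero with lookup S u xor y
  ... | true  = cong suc (cutSize-row u ys (h ∘ suc) (right ∘ suc))
  ... | false = cutSize-row u ys (h ∘ suc) (right ∘ suc)

  cutSize-rows : ∀ {k} (xs : Subset k) (g : Fin k → Fin n) → (∀ i → lookup S (g i ↑ˡ n) ≡ lookup xs i) →
                 (ys : Subset n) → (∀ j → lookup S (n ↑ʳ j) ≡ lookup ys j) →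
                 cutSize (cartesianProductWith (λ i j → (i ↑ˡ n , n ↑ʳ j)) (tabulate g) (allFin n)) S
                   ≡ mismatches xs ys
  cutSize-rows []       g left ys right = refl
  cutSize-rows (x ∷ xs) g left ys right = begin
    cutSize (row ++ₗ rows) S
      ≡⟨ cutSize-++ row rows S ⟩
    cutSize row S + cutSize rows S
      ≡⟨ cong₂ _+_ (cutSize-row u ys (λ j → j) right) (cutSize-rows xs (g ∘ suc) (left ∘ suc) ys right) ⟩
    ∣ map (lookup S u xor_) ys ∣ + mismatches xs ys
      ≡⟨ cong (λ b → ∣ map (b xor_) ys ∣ + mismatches xs ys) (left zero) ⟩
    ∣ map (x xor_) ys ∣ + mismatches xs ys
      ≡⟨ mismatches-∷ x xs ys ⟩
    mismatches (x ∷ xs) ys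
      ∎
    where
    open ≡-Reasoning
    u : Fin (n + n)
    u = g zero ↑ˡ n
    row rows : List (Fin (n + n) × Fin (n + n))
    row = mapₗ (λ j → (u , n ↑ʳ j)) (allFin n)
    rows = cartesianProductWith (λ i j → (i ↑ˡ n , n ↑ʳ j)) (tabulate (g ∘ suc)) (allFin n)

cutSize-K : ∀ {n} (xs ys : Subset n) → cutSize (edges (K n)) (xs ++ ys) ≡ mismatches xs ys
cutSize-K xs ys = cutSize-rows (xs ++ ys) xs (λ i → i) (lookup-++ˡ xs ys) ys (lookup-++ʳ xs ys)

suc+suc≤suc*suc+1 : ∀ m n → suc m + suc n ≤ suc m * suc n + 1
suc+suc≤suc*suc+1 m n = begin
  suc m + suc n        ≡⟨ +-comm (suc m) (suc n) ⟩
  suc n + suc m        ≡⟨ +-suc (suc n) m ⟩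
  suc (suc n + m)      ≤⟨ s≤s (+-monoʳ-≤ (suc n) (m≤m*n m (suc n))) ⟩
  suc (suc n + m * suc n) ≡⟨ +-comm 1 _ ⟩
  suc m * suc n + 1    ∎
  where open ≤-Reasoning

n+n≤m*n : ∀ n {m} → 2 ≤ m → n + n ≤ m * n
n+n≤m*n n {m} 2≤m = subst (_≤ m * n) (cong (n +_) (+-identityʳ n)) (*-monoˡ-≤ n 2≤m)

n+n≤n*m : ∀ n {m} → 2 ≤ m → n + n ≤ n * m
n+n≤n*m n {m} 2≤m = subst (n + n ≤_) (*-comm m n) (n+n≤m*n n 2≤m)

m≤m+n+2 : ∀ m n → m ≤ m + n + 2
m≤m+n+2 m n = ≤-trans (m≤m+n m n) (m≤m+n _ 2)

n≤m+n+2 : ∀ m n → n ≤ m + n + 2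
n≤m+n+2 m n = ≤-trans (m≤n+m n m) (m≤m+n _ 2)

-- Either one of a, b, c, d is 0, and then a full side is cut against at least two vertices,
-- or all are positive, and then a d ≥ a + d − 1 and c b ≥ c + b − 1.
n+n≤a*d+c*b+2 : ∀ {n} a b c d → a + c ≡ n → b + d ≡ n → 2 ≤ a + b → 2 ≤ c + d →
                n + n ≤ a * d + c * b + 2
n+n≤a*d+c*b+2 zero b c d refl _ 2≤b _ = ≤-trans (n+n≤n*m c 2≤b) (n≤m+n+2 0 (c * b))
n+n≤a*d+c*b+2 (suc a) zero c d _ refl 2≤a _ =
  ≤-trans (n+n≤m*n d (subst (2 ≤_) (+-identityʳ (suc a)) 2≤a)) (m≤m+n+2 (suc a * d) (c * 0))
n+n≤a*d+c*b+2 (suc a) (suc b) zero d a≡n _ _ 2≤d =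
  subst (λ n → n + n ≤ _) (trans (sym (+-identityʳ (suc a))) a≡n)
        (≤-trans (n+n≤n*m (suc a) 2≤d) (m≤m+n+2 (suc a * d) 0))
n+n≤a*d+c*b+2 (suc a) (suc b) (suc c) zero _ b≡n _ 2≤c =
  subst (λ n → n + n ≤ _) (trans (sym (+-identityʳ (suc b))) b≡n)
        (≤-trans (n+n≤m*n (suc b) (subst (2 ≤_) (+-identityʳ (suc c)) 2≤c))
                 (n≤m+n+2 (suc a * 0) (suc c * suc b)))
n+n≤a*d+c*b+2 {n} (suc a) (suc b) (suc c) (suc d) a+c≡n b+d≡n _ _ = begin
  n + n                                  ≡⟨ cong₂ _+_ (sym a+c≡n) (trans (sym b+d≡n) (+-comm (suc b) (suc d))) ⟩
  (suc a + suc c) + (suc d + suc b)       ≡⟨ interchange (suc a) (suc c) (suc d) (suc b) ⟩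
  (suc a + suc d) + (suc c + suc b)       ≤⟨ +-mono-≤ (suc+suc≤suc*suc+1 a d) (suc+suc≤suc*suc+1 c b) ⟩
  (suc a * suc d + 1) + (suc c * suc b + 1) ≡⟨ interchange (suc a * suc d) 1 (suc c * suc b) 1 ⟩
  suc a * suc d + suc c * suc b + 2       ∎
  where open ≤-Reasoning

K-cutSize-lowerBound : ∀ n (S : Subset (n + n)) → 2 ≤ ∣ S ∣ → 2 ≤ ∣ ∁ S ∣ →
                       n + n ≤ cutSize (edges (K n)) S + 2
K-cutSize-lowerBound n S 2≤∣S∣ 2≤∣∁S∣ with Data.Vec.splitAt n S
... | xs , ys , refl =
  subst (λ c → n + n ≤ c + 2) (sym (cutSize-K xs ys))
        (n+n≤a*d+c*b+2 (∣ xs ∣) (∣ ys ∣) (∣ ∁ xs ∣) (∣ ∁ ys ∣) (∣p∣+∣∁p∣≡n xs) (∣p∣+∣∁p∣≡n ys)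
                       (subst (2 ≤_) (∣p++q∣≡∣p∣+∣q∣ xs ys) 2≤∣S∣)
                       (subst (2 ≤_) (∣∁[p++q]∣≡∣∁p∣+∣∁q∣ xs ys) 2≤∣∁S∣))

K-smallCutSetsAreTiny : ∀ n w → w + 3 ≤ n + n → SmallCutSetsAreTiny (K n) w
K-smallCutSetsAreTiny n w w+3≤n+n S cut≤w ∣S∣≤w with 2 ≤? ∣ S ∣
... | no  2≰∣S∣ = ≤-pred (≰⇒> 2≰∣S∣)
... | yes 2≤∣S∣ = ⊥-elim (3≰2 (+-cancelˡ-≤ w 3 2 (begin
  w + 3                        ≤⟨ w+3≤n+n ⟩
  n + n                        ≤⟨ K-cutSize-lowerBound n S 2≤∣S∣ 2≤∣∁S∣ ⟩
  cutSize (edges (K n)) S + 2  ≤⟨ +-monoˡ-≤ 2 cut≤w ⟩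
  w + 2                        ∎)))
  where
  open ≤-Reasoning
  3≰2 : ¬ 3 ≤ 2
  3≰2 (s≤s (s≤s ()))
  2≤∣∁S∣ : 2 ≤ ∣ ∁ S ∣
  2≤∣∁S∣ = ≤-trans (n≤1+n 2) (+-cancelˡ-≤ (∣ S ∣) 3 (∣ ∁ S ∣) (begin
    ∣ S ∣ + 3        ≤⟨ +-monoˡ-≤ 3 ∣S∣≤w ⟩
    w + 3            ≤⟨ w+3≤n+n ⟩
    n + n            ≡⟨ ∣p∣+∣∁p∣≡n S ⟨
    ∣ S ∣ + ∣ ∁ S ∣  ∎))

w<m∸2⇒w+3≤m : ∀ {w} m → w < m ∸ 2 → w + 3 ≤ m
w<m∸2⇒w+3≤m (suc (suc m)) w<m = subst (_≤ 2 + m) (+-comm 3 _) (s≤s (s≤s w<m))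

K-noTreecutDecompBelow : ∀ n w → w < 2 * n ∸ 2 → ¬ HasTreecutDecompOfWidth≤ (K n) w
K-noTreecutDecompBelow n w w<2n∸2 D = m+1+n≰m w (≤-trans w+3≤n+n (vertices≤width (K n) w tiny D))
  where
  w+3≤n+n : w + 3 ≤ n + n
  w+3≤n+n = subst (w + 3 ≤_) (cong (n +_) (+-identityʳ n)) (w<m∸2⇒w+3≤m (2 * n) w<2n∸2)
  tiny : SmallCutSetsAreTiny (K n) w
  tiny = K-smallCutSetsAreTiny n w w+3≤n+n

doubled : ∀ {n} → Subset n → Subset (n + n)
doubled p = p ++ p

occurrences-doubledˡ : ∀ {n} (bs : List (Subset n)) i → occurrences (i ↑ˡ n) (mapₗ doubled bs) ≡ occurrences i bs
occurrences-doubledˡ []       i = refl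
occurrences-doubledˡ (b ∷ bs) i =
  cong₂ _+_ (cong (λ x → if x then 1 else 0) (lookup-++ˡ b b i)) (occurrences-doubledˡ bs i)

occurrences-doubledʳ : ∀ {n} (bs : List (Subset n)) i → occurrences (n ↑ʳ i) (mapₗ doubled bs) ≡ occurrences i bs
occurrences-doubledʳ []       i = refl
occurrences-doubledʳ (b ∷ bs) i =
  cong₂ _+_ (cong (λ x → if x then 1 else 0) (lookup-++ʳ b b i)) (occurrences-doubledʳ bs i)

doubled-exactlyOnce : ∀ {n} (bs : List (Subset n)) → (∀ i → occurrences i bs ≡ 1) →
                      ∀ v → occurrences v (mapₗ doubled bs) ≡ 1
doubled-exactlyOnce {n} bs once v with splitAt n v in split
... | inj₁ i = subst (λ u → occurrences u (mapₗ doubled bs) ≡ 1) (splitAt⁻¹-↑ˡ split)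
                     (trans (occurrences-doubledˡ bs i) (once i))
... | inj₂ i = subst (λ u → occurrences u (mapₗ doubled bs) ≡ 1) (splitAt⁻¹-↑ʳ split)
                     (trans (occurrences-doubledʳ bs i) (once i))

cutSize-K-doubled⁅⁆ : ∀ {n} (i : Fin (suc n)) → cutSize (edges (K (suc n))) (doubled ⁅ i ⁆) ≡ n + n
cutSize-K-doubled⁅⁆ {n} i = begin
  cutSize (edges (K (suc n))) (doubled ⁅ i ⁆)    ≡⟨ cutSize-K ⁅ i ⁆ ⁅ i ⁆ ⟩
  ∣ ⁅ i ⁆ ∣ * ∣ ∁ ⁅ i ⁆ ∣ + ∣ ∁ ⁅ i ⁆ ∣ * ∣ ⁅ i ⁆ ∣ ≡⟨ cong₂ (λ a c → a * c + c * a) (∣⁅x⁆∣≡1 i) ∣∁⁅i⁆∣≡n ⟩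
  1 * n + n * 1                                   ≡⟨ cong₂ _+_ (*-identityˡ n) (*-identityʳ n) ⟩
  n + n                                           ∎
  where
  open ≡-Reasoning
  ∣∁⁅i⁆∣≡n : ∣ ∁ ⁅ i ⁆ ∣ ≡ n
  ∣∁⁅i⁆∣≡n = trans (∣∁p∣≡n∸∣p∣ ⁅ i ⁆) (cong (suc n ∸_) (∣⁅x⁆∣≡1 i))

module TwoPairsBelowRest (m : ℕ) where

  rest : Subset (2 + m)
  rest = outside ∷ outside ∷ ⊤

  pair : Fin (2 + m) → RTree (Subset ((2 + m) + (2 + m)))
  pair i = node (doubled ⁅ i ⁆) []

  decomposition : RTree (Subset ((2 + m) + (2 + m)))
  decomposition = node (doubled rest) (pair zero ∷ pair (suc zero) ∷ [])

  nearPartition : NearPartition decomposition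
  nearPartition = doubled-exactlyOnce (rest ∷ ⁅ zero ⁆ ∷ ⁅ suc zero ⁆ ∷ []) once
    where
    once : ∀ i → occurrences i (rest ∷ ⁅ zero ⁆ ∷ ⁅ suc zero ⁆ ∷ []) ≡ 1
    once zero             = refl
    once (suc zero)       = refl
    once (suc (suc i)) rewrite lookup-replicate i inside | lookup-replicate i outside = refl

  pair-ok : 1 ≤ m → ∀ i → NodesOK (K (2 + m)) (suc m + suc m) false (pair i)
  pair-ok 1≤m i = ≤-reflexive (trans (cong (cutSize (edges (K (2 + m)))) (∪-identityʳ (doubled ⁅ i ⁆)))
                                     (cutSize-K-doubled⁅⁆ i))
                , subst (λ s → s + 0 + 1 ≤ suc m + suc m) (sym ∣doubled⁅i⁆∣≡2) (+-mono-≤ (s≤s 1≤m) (s≤s z≤n))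
                , tt
    where
    ∣doubled⁅i⁆∣≡2 : ∣ doubled ⁅ i ⁆ ∣ ≡ 2
    ∣doubled⁅i⁆∣≡2 = trans (∣p++q∣≡∣p∣+∣q∣ ⁅ i ⁆ ⁅ i ⁆) (cong₂ _+_ (∣⁅x⁆∣≡1 i) (∣⁅x⁆∣≡1 i))

  decomposition-ok : 1 ≤ m → NodesOK (K (2 + m)) (suc m + suc m) true decomposition
  decomposition-ok 1≤m = subst (_≤ suc m + suc m) (sym adhesion≡0) z≤n
                       , ≤-reflexive torso≡
                       , pair-ok 1≤m zero , pair-ok 1≤m (suc zero) , tt
    where
    adhesion≡0 : cutSize (edges (K (2 + m))) (subtreeSet decomposition) ≡ 0
    adhesion≡0 = trans (cong (cutSize (edges (K (2 + m)))) (subtreeSet≡⊤ decomposition nearPartition))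
                       (cutSize-⊤ (edges (K (2 + m))))
    torso≡ : ∣ doubled rest ∣ + 2 + 0 ≡ suc m + suc m
    torso≡ = trans (cong (λ s → s + 2 + 0) (trans (∣p++q∣≡∣p∣+∣q∣ rest rest) (cong₂ _+_ (∣⊤∣≡n m) (∣⊤∣≡n m))))
                   (trans (+-identityʳ _) (trans (+-comm (m + m) 2) (cong suc (sym (+-suc m m)))))

width≡ : ∀ m → 2 * (2 + m) ∸ 2 ≡ suc m + suc m
width≡ m = trans (+-suc m (suc (m + 0))) (cong (λ x → suc (m + suc x)) (+-identityʳ m))

K-hasTreecutDecompOfWidth : ∀ m → 1 ≤ m → HasTreecutDecompOfWidth≤ (K (2 + m)) (2 * (2 + m) ∸ 2)
K-hasTreecutDecompOfWidth m 1≤m =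
  decomposition , nearPartition
  , subst (λ w → NodesOK (K (2 + m)) w true decomposition) (sym (width≡ m)) (decomposition-ok 1≤m)
  where open TwoPairsBelowRest m

mainTheorem3 : ∀ (n : ℕ) → 3 ≤ n → TreecutWidth≡ (K n) (2 * n ∸ 2)
mainTheorem3 (suc (suc m)) (s≤s (s≤s 1≤m)) = K-hasTreecutDecompOfWidth m 1≤m , K-noTreecutDecompBelow (2 + m)
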